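{- For every integer $n\ge 2$, the domination polynomial of the flower graph $F_{4,n}$ satisfies \[ D(F_{4,n},x)=\big((1+x)^3+x\big)D(F_{4,n-1},x)-(1+3x)(x+3x^2+x^3)^{n-1}+(1+x)^3x^{n-1}-(x^2+x)(x^3+3x^2+3x)^{n-1}, \] where $D(F_{4,1},x)=x^4+4x^3+6x^2$.
   Context: All graphs are finite and simple. For a graph $G=(V,E)$, a set $S\subseteq V$ is dominating if every vertex of $V\setminus S$ is adjacent to a vertex of $S$. Let $d(G,i)$ be the number of dominating sets of $G$ of size $i$; the domination polynomial is $D(G,x)=\sum_{i=\gamma(G)}^{|V|} d(G,i)x^i$, where $\gamma(G)$ is the minimum size of a dominating set. For $q\ge 3$ and $n\ge 1$, the generalized friendship graph (flower) $F_{q,n}$ is the graph formed by $n$ cycles, each of order $q$, all sharing exactly one common vertex (and otherwise pairwise disjoint). In particular $F_{4,n}$ consists of $n$ copies of the $4$-cycle $C_4$ meeting at a single common vertex, and $F_{4,1}=C_4$. -}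

module Defs where

open import Data.Bool using (Bool; true; false)
open import Data.Nat using (ℕ; zero; suc; _*_; _∸_; _≤_) renaming (_+_ to _+ℕ_)
import Data.Nat as ℕ
open import Data.Integer using (ℤ; +_; _+_; _-_) renaming (_*_ to _*ℤ_)
open import Data.Fin using (Fin; zero; suc; remQuot; toℕ)
open import Data.Fin.Subset using (Subset; _∈_; ∣_∣)
open import Data.Fin.Subset.Properties using (_∈?_)
open import Data.Fin.Properties using (all?; any?)
open import Data.Vec using (Vec; []; _∷_)
open import Data.List using (List; []; _∷_; _++_; map; filter; length)
open import Data.Product using (Σ; ∃; _×_; _,_; proj₂)
open import Data.Empty using (⊥-elim)
import Data.Fin as Fin
import Relation.Binary.PropositionalEquality as ≡
open import Data.Sum using (_⊎_)
open import Relation.Binary.PropositionalEquality using (_≡_; refl)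
open import Relation.Nullary using (Dec; yes; no)
open import Relation.Nullary.Decidable using (_×-dec_; _⊎-dec_)
open import Data.Bool.Properties using () renaming (_≟_ to _≟𝔹_)

record Graph : Set where
  field
    N      : ℕ
    adj    : Fin N → Fin N → Bool
    sym    : ∀ u v → adj u v ≡ adj v u
    irrefl : ∀ v → adj v v ≡ false
open Graph public

Dominating : (G : Graph) → Subset (N G) → Set
Dominating G S = ∀ v → v ∈ S ⊎ ∃ λ u → u ∈ S × adj G u v ≡ true

dominating? : (G : Graph) → (S : Subset (N G)) → Dec (Dominating G S)
dominating? G S =
  all? λ v → (v ∈? S) ⊎-dec any? (λ u → (u ∈? S) ×-dec (adj G u v ≟𝔹 true))

allSubsets : (n : ℕ) → List (Subset n)
allSubsets zero    = [] ∷ []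
allSubsets (suc n) = map (false ∷_) (allSubsets n) ++ map (true ∷_) (allSubsets n)

d : Graph → ℕ → ℕ
d G i = length (filter (λ S → (∣ S ∣ ℕ.≟ i) ×-dec dominating? G S) (allSubsets (N G)))

-- Polynomials with integer coefficients, as coefficient sequences ℕ → ℤ
-- (p k = coefficient of x^k)

Poly : Set
Poly = ℕ → ℤ

-- domination polynomial D(G,x) = Σ_i d(G,i) x^i
-- (d(G,i) = 0 for i < γ(G) and for i > |V|, so this is the paper's sum)
D : Graph → Poly
D G i = + d G i

X : Poly
X 0 = + 0
X 1 = + 1
X (suc (suc _)) = + 0

cst : ℤ → Poly
cst c 0 = c
cst c (suc _) = + 0

infixl 6 _⊕_ _⊖_
infixl 7 _⊛_
infixr 8 _^^_

_⊕_ : Poly → Poly → Poly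
(p ⊕ q) k = p k + q k

_⊖_ : Poly → Poly → Poly
(p ⊖ q) k = p k - q k

sumTo : ℕ → (ℕ → ℤ) → ℤ
sumTo zero    f = f 0
sumTo (suc k) f = sumTo k f + f (suc k)

_⊛_ : Poly → Poly → Poly
(p ⊛ q) k = sumTo k (λ i → p i *ℤ q (k ∸ i))

_^^_ : Poly → ℕ → Poly
p ^^ zero  = cst (+ 1)
p ^^ suc n = p ⊛ (p ^^ n)

κ : ℕ → Poly
κ n = cst (+ n)

-- The flower F_{4,n}: vertex 0 is the common vertex; vertex suc j with
-- remQuot 3 j = (i , r) is vertex r of the i-th petal, the i-th 4-cycle being
--   centre – (i,0) – (i,1) – (i,2) – centre.

step : Fin 3 → Fin 3 → Bool
step zero zero = false
step zero (suc zero) = true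
step zero (suc (suc zero)) = false
step (suc zero) zero = true
step (suc zero) (suc zero) = false
step (suc zero) (suc (suc zero)) = true
step (suc (suc zero)) zero = false
step (suc (suc zero)) (suc zero) = true
step (suc (suc zero)) (suc (suc zero)) = false

petalAdj : ∀ {n} → Fin n × Fin 3 → Fin n × Fin 3 → Bool
petalAdj (i , r) (j , s) with i Fin.≟ j
... | no _ = false
... | yes _ = step r s

centreAdj : Fin 3 → Bool
centreAdj zero = true
centreAdj (suc zero) = false
centreAdj (suc (suc zero)) = true

flowerAdj : (n : ℕ) → Fin (suc (n * 3)) → Fin (suc (n * 3)) → Bool
flowerAdj n zero    zero    = false
flowerAdj n zero    (suc j) = centreAdj (proj₂ (remQuot {n} 3 j))
flowerAdj n (suc j) zero    = centreAdj (proj₂ (remQuot {n} 3 j))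
flowerAdj n (suc j) (suc k) = petalAdj (remQuot {n} 3 j) (remQuot {n} 3 k)

step-sym : ∀ r s → step r s ≡ step s r
step-sym zero zero = refl
step-sym zero (suc zero) = refl
step-sym zero (suc (suc zero)) = refl
step-sym (suc zero) zero = refl
step-sym (suc zero) (suc zero) = refl
step-sym (suc zero) (suc (suc zero)) = refl
step-sym (suc (suc zero)) zero = refl
step-sym (suc (suc zero)) (suc zero) = refl
step-sym (suc (suc zero)) (suc (suc zero)) = refl

step-irr : ∀ r → step r r ≡ false
step-irr zero = refl
step-irr (suc zero) = refl
step-irr (suc (suc zero)) = refl

petal-sym : ∀ {n} (a b : Fin n × Fin 3) → petalAdj a b ≡ petalAdj b a
petal-sym (i , r) (j , s) with i Fin.≟ j | j Fin.≟ i
... | yes _ | yes _ = step-sym r s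
... | no _  | no _  = refl
... | yes p | no q  = ⊥-elim (q (≡.sym p))
... | no p  | yes q = ⊥-elim (p (≡.sym q))

petal-irr : ∀ {n} (a : Fin n × Fin 3) → petalAdj a a ≡ false
petal-irr (i , r) with i Fin.≟ i
... | yes _ = step-irr r
... | no p  = ⊥-elim (p refl)

flower-sym : ∀ n u v → flowerAdj n u v ≡ flowerAdj n v u
flower-sym n zero zero = refl
flower-sym n zero (suc j) = refl
flower-sym n (suc j) zero = refl
flower-sym n (suc j) (suc k) = petal-sym (remQuot {n} 3 j) (remQuot {n} 3 k)

flower-irr : ∀ n v → flowerAdj n v v ≡ false
flower-irr n zero = refl
flower-irr n (suc j) = petal-irr (remQuot {n} 3 j)

F4 : ℕ → Graph
F4 n = record
  { N = suc (n * 3) ; adj = flowerAdj n ; sym = flower-sym n ; irrefl = flower-irr n }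

-- Write S = c ∷ R, where c says whether the centre is in S.  If c holds, S dominates
-- iff every petal a–b–e contains some vertex, so each petal contributes
-- Q = (1+x)³ − 1.  If c fails, every petal must dominate itself (weight
-- P = x + 3x² + x³ each) and some petal must meet a neighbour of the centre; the
-- petal configurations missing the latter are exactly those where every petal is its
-- middle vertex alone (weight x each).  Hence D(F₄,ₙ) = Pⁿ − xⁿ + x·Qⁿ, and the
-- recurrence becomes a polynomial identity in x, Pⁿ⁻¹, xⁿ⁻¹, Qⁿ⁻¹, checked by the
-- ring solver once the coefficient sequences with convolution are shown to form a
-- commutative ring.

module Submission where

open import Defs hiding (sym)
open import Algebra.Bundles using (CommutativeRing)
open import Algebra.Structures using (IsCommutativeRing)
import Algebra.Construct.Pointwise as Pointwise
open import Algebra.Solver.Ring.AlmostCommutativeRing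
  using (_-Raw-AlmostCommutative⟶_; fromCommutativeRing)
open import Data.Bool using (Bool; true; false; _∧_; _∨_; not; if_then_else_)
open import Data.Bool.Properties using (∧-zeroʳ; ∧-identityʳ; ∨-identityʳ; ∧-assoc)
import Data.Bool.Properties as 𝔹
open import Data.Fin using (Fin; zero; suc; remQuot)
import Data.Fin as Fin
open import Data.Fin.Subset using (Subset; _∈_; ∣_∣)
open import Data.Fin.Subset.Properties using (_∈?_)
open import Data.Fin.Properties using (all?; any?)
open import Data.Integer using (ℤ; +_; +0; _+_; _-_; -_) renaming (_*_ to _*ℤ_)
import Data.Integer as ℤ
import Data.Integer.Properties as ℤ
open import Algebra.Properties.CommutativeSemigroup ℤ.+-commutativeSemigroup using (interchange)
open import Data.List using (List; []; _∷_; map; filter; length) renaming (_++_ to _++ₗ_)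
open import Data.List.Properties using (filter-++; length-++)
open import Data.Maybe using (Maybe; just; nothing)
import Data.Nat as ℕ
open import Data.Nat using (ℕ; zero; suc; _*_; _∸_; _≤_; _≥_; z≤n)
open import Data.Nat.Properties using (≤-refl; m≤n⇒m≤1+n; n∸n≡0; +-∸-assoc; m∸[m∸n]≡n)
open import Data.Product using (_×_; _,_; proj₁; proj₂)
open import Data.Vec using ([]; _∷_; _++_; lookup)
open import Data.Vec.Functional using (foldr)
open import Function using (_∘_)
open import Level using (Level)
open import Relation.Binary.PropositionalEquality
  using (_≡_; _≗_; refl; sym; trans; cong; cong₂; module ≡-Reasoning)
import Relation.Binary.Reasoning.Setoid as SetoidReasoning
open import Relation.Nullary using (does; yes; no)
open import Relation.Nullary.Decidable using (_×-dec_; _⊎-dec_)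
open import Relation.Unary using (Pred; Decidable)

private variable
  a ℓ : Level
  A B : Set a

-- Finite sums

sumTo-cong : ∀ k {f g : ℕ → ℤ} → (∀ i → i ≤ k → f i ≡ g i) → sumTo k f ≡ sumTo k g
sumTo-cong zero    f≡g = f≡g 0 z≤n
sumTo-cong (suc k) f≡g =
  cong₂ _+_ (sumTo-cong k λ i i≤k → f≡g i (m≤n⇒m≤1+n i≤k)) (f≡g (suc k) ≤-refl)

sumTo-+ : ∀ k (f g : ℕ → ℤ) → sumTo k (λ i → f i + g i) ≡ sumTo k f + sumTo k g
sumTo-+ zero    f g = refl
sumTo-+ (suc k) f g = begin
  sumTo k (λ i → f i + g i) + (f (suc k) + g (suc k))
    ≡⟨ cong (_+ (f (suc k) + g (suc k))) (sumTo-+ k f g) ⟩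
  (sumTo k f + sumTo k g) + (f (suc k) + g (suc k))
    ≡⟨ interchange (sumTo k f) (sumTo k g) (f (suc k)) (g (suc k)) ⟩
  sumTo (suc k) f + sumTo (suc k) g ∎
  where open ≡-Reasoning

sumTo-*ˡ : ∀ k c (f : ℕ → ℤ) → sumTo k (λ i → c *ℤ f i) ≡ c *ℤ sumTo k f
sumTo-*ˡ zero    c f = refl
sumTo-*ˡ (suc k) c f = begin
  sumTo k (λ i → c *ℤ f i) + c *ℤ f (suc k) ≡⟨ cong (_+ c *ℤ f (suc k)) (sumTo-*ˡ k c f) ⟩
  c *ℤ sumTo k f + c *ℤ f (suc k)            ≡⟨ ℤ.*-distribˡ-+ c (sumTo k f) (f (suc k)) ⟨
  c *ℤ sumTo (suc k) f                      ∎
  where open ≡-Reasoning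

sumTo-zero : ∀ k → sumTo k (λ _ → +0) ≡ +0
sumTo-zero zero    = refl
sumTo-zero (suc k) = cong (_+ +0) (sumTo-zero k)

sumTo-head : ∀ k (f : ℕ → ℤ) → sumTo (suc k) f ≡ f 0 + sumTo k (f ∘ suc)
sumTo-head zero    f = refl
sumTo-head (suc k) f = begin
  sumTo (suc k) f + f (suc (suc k))            ≡⟨ cong (_+ f (suc (suc k))) (sumTo-head k f) ⟩
  (f 0 + sumTo k (f ∘ suc)) + f (suc (suc k))  ≡⟨ ℤ.+-assoc (f 0) (sumTo k (f ∘ suc)) _ ⟩
  f 0 + sumTo (suc k) (f ∘ suc)                ∎
  where open ≡-Reasoning

sumTo-reverse : ∀ k (f : ℕ → ℤ) → sumTo k f ≡ sumTo k (λ i → f (k ∸ i))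
sumTo-reverse zero    f = refl
sumTo-reverse (suc k) f = begin
  sumTo (suc k) f                        ≡⟨ sumTo-head k f ⟩
  f 0 + sumTo k (f ∘ suc)                ≡⟨ cong (λ s → f 0 + s) (sumTo-reverse k (f ∘ suc)) ⟩
  f 0 + sumTo k (λ i → f (suc (k ∸ i)))  ≡⟨ ℤ.+-comm (f 0) _ ⟩
  sumTo k (λ i → f (suc (k ∸ i))) + f 0  ≡⟨ cong₂ _+_ (sumTo-cong k λ i i≤k → cong f (sym (+-∸-assoc 1 i≤k)))
                                                     (cong f (sym (n∸n≡0 k))) ⟩
  sumTo (suc k) (λ i → f (suc k ∸ i))    ∎
  where open ≡-Reasoning

-- Polynomials under convolution form a commutative ring

infixl 7 _·_
_·_ : ℤ → Poly → Poly
(c · p) k = c *ℤ p k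

0ₚ : Poly
0ₚ _ = +0

-ₚ_ : Poly → Poly
(-ₚ p) k = - p k

shift : Poly → Poly
shift p zero    = +0
shift p (suc k) = p k

shift-cong : ∀ {p q} → p ≗ q → shift p ≗ shift q
shift-cong p≗q zero    = refl
shift-cong p≗q (suc k) = p≗q k

shift-⊕ : ∀ p q → shift (p ⊕ q) ≗ shift p ⊕ shift q
shift-⊕ p q zero    = refl
shift-⊕ p q (suc k) = refl

⊛-cong : ∀ {p p′ q q′} → p ≗ p′ → q ≗ q′ → p ⊛ q ≗ p′ ⊛ q′
⊛-cong p≗p′ q≗q′ k = sumTo-cong k λ i _ → cong₂ _*ℤ_ (p≗p′ i) (q≗q′ (k ∸ i))

⊛-zeroˡ : ∀ q → 0ₚ ⊛ q ≗ 0ₚ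
⊛-zeroˡ q k = sumTo-zero k

⊛-distribʳ : ∀ r p q → (p ⊕ q) ⊛ r ≗ p ⊛ r ⊕ q ⊛ r
⊛-distribʳ r p q k = begin
  sumTo k (λ i → (p i + q i) *ℤ r (k ∸ i))
    ≡⟨ sumTo-cong k (λ i _ → ℤ.*-distribʳ-+ (r (k ∸ i)) (p i) (q i)) ⟩
  sumTo k (λ i → p i *ℤ r (k ∸ i) + q i *ℤ r (k ∸ i))  ≡⟨ sumTo-+ k _ _ ⟩
  (p ⊛ r ⊕ q ⊛ r) k                                    ∎
  where open ≡-Reasoning

·-⊛ : ∀ c p q → (c · p) ⊛ q ≗ c · (p ⊛ q)
·-⊛ c p q k = begin
  sumTo k (λ i → c *ℤ p i *ℤ q (k ∸ i))    ≡⟨ sumTo-cong k (λ i _ → ℤ.*-assoc c (p i) (q (k ∸ i))) ⟩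
  sumTo k (λ i → c *ℤ (p i *ℤ q (k ∸ i)))  ≡⟨ sumTo-*ˡ k c _ ⟩
  (c · (p ⊛ q)) k                          ∎
  where open ≡-Reasoning

shift-⊛ : ∀ p q → shift p ⊛ q ≗ shift (p ⊛ q)
shift-⊛ p q zero    = refl
shift-⊛ p q (suc k) = trans (sumTo-head k _) (ℤ.+-identityˡ _)

⊛-unfoldˡ : ∀ p q → p ⊛ q ≗ p 0 · q ⊕ shift ((p ∘ suc) ⊛ q)
⊛-unfoldˡ p q zero    = sym (ℤ.+-identityʳ _)
⊛-unfoldˡ p q (suc k) = sumTo-head k _

cst-⊛ : ∀ c q → cst c ⊛ q ≗ c · q
cst-⊛ c q k = begin
  (cst c ⊛ q) k                ≡⟨ ⊛-unfoldˡ (cst c) q k ⟩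
  c *ℤ q k + shift (0ₚ ⊛ q) k  ≡⟨ cong (λ s → c *ℤ q k + s) (shift-cong (⊛-zeroˡ q) k) ⟩
  c *ℤ q k + shift 0ₚ k        ≡⟨ cong (λ s → c *ℤ q k + s) (shift-0 k) ⟩
  c *ℤ q k + +0                ≡⟨ ℤ.+-identityʳ _ ⟩
  (c · q) k                    ∎
  where
  open ≡-Reasoning
  shift-0 : shift 0ₚ ≗ 0ₚ
  shift-0 zero    = refl
  shift-0 (suc k) = refl

⊛-identityˡ : ∀ p → κ 1 ⊛ p ≗ p
⊛-identityˡ p k = trans (cst-⊛ (+ 1) p k) (ℤ.*-identityˡ (p k))

⊛-comm : ∀ p q → p ⊛ q ≗ q ⊛ p
⊛-comm p q k = begin
  sumTo k (λ i → p i *ℤ q (k ∸ i))              ≡⟨ sumTo-reverse k _ ⟩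
  sumTo k (λ i → p (k ∸ i) *ℤ q (k ∸ (k ∸ i)))  ≡⟨ sumTo-cong k (λ i i≤k →
                                                     trans (ℤ.*-comm (p (k ∸ i)) _)
                                                           (cong (λ j → q j *ℤ p (k ∸ i)) (m∸[m∸n]≡n i≤k))) ⟩
  sumTo k (λ i → q i *ℤ p (k ∸ i))              ∎
  where open ≡-Reasoning

-- Induction on the degree k, peeling the constant term off the first factor.
⊛-assoc : ∀ p q r → (p ⊛ q) ⊛ r ≗ p ⊛ (q ⊛ r)
⊛-assoc p q r k = begin
  ((p ⊛ q) ⊛ r) k                                    ≡⟨ ⊛-cong {q = r} (⊛-unfoldˡ p q) (λ _ → refl) k ⟩
  ((p 0 · q ⊕ shift ((p ∘ suc) ⊛ q)) ⊛ r) k          ≡⟨ ⊛-distribʳ r (p 0 · q) (shift ((p ∘ suc) ⊛ q)) k ⟩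
  ((p 0 · q) ⊛ r) k + (shift ((p ∘ suc) ⊛ q) ⊛ r) k
    ≡⟨ cong₂ _+_ (·-⊛ (p 0) q r k) (shift-⊛ ((p ∘ suc) ⊛ q) r k) ⟩
  p 0 *ℤ (q ⊛ r) k + shift (((p ∘ suc) ⊛ q) ⊛ r) k   ≡⟨ cong (λ s → p 0 *ℤ (q ⊛ r) k + s) (tail-assoc k) ⟩
  p 0 *ℤ (q ⊛ r) k + shift ((p ∘ suc) ⊛ (q ⊛ r)) k   ≡⟨ ⊛-unfoldˡ p (q ⊛ r) k ⟨
  (p ⊛ (q ⊛ r)) k                                    ∎
  where
  open ≡-Reasoning
  tail-assoc : ∀ k → shift (((p ∘ suc) ⊛ q) ⊛ r) k ≡ shift ((p ∘ suc) ⊛ (q ⊛ r)) k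
  tail-assoc zero    = refl
  tail-assoc (suc k) = ⊛-assoc (p ∘ suc) q r k

Poly-isCommutativeRing : IsCommutativeRing _≗_ _⊕_ _⊛_ -ₚ_ 0ₚ (κ 1)
Poly-isCommutativeRing = record
  { isRing = record
    { +-isAbelianGroup = Pointwise.isAbelianGroup ℕ ℤ.+-0-isAbelianGroup
    ; *-cong           = ⊛-cong
    ; *-assoc          = ⊛-assoc
    ; *-identity       = ⊛-identityˡ , λ p k → trans (⊛-comm p (κ 1) k) (⊛-identityˡ p k)
    ; distrib          = (λ r p q k → trans (⊛-comm r (p ⊕ q) k)
                                        (trans (⊛-distribʳ r p q k) (cong₂ _+_ (⊛-comm p r k) (⊛-comm q r k))))
                       , ⊛-distribʳ
    }
  ; *-comm = ⊛-comm
  }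

Poly-commutativeRing : CommutativeRing _ _
Poly-commutativeRing = record { isCommutativeRing = Poly-isCommutativeRing }

cst-homomorphism : ℤ.+-*-rawRing -Raw-AlmostCommutative⟶ fromCommutativeRing Poly-commutativeRing
cst-homomorphism = record
  { ⟦_⟧    = cst
  ; +-homo = λ { a b zero → refl ; a b (suc k) → refl }
  ; *-homo = λ a b k → sym (trans (cst-⊛ a (cst b) k) (scaled-cst a b k))
  ; -‿homo = λ { a zero → refl ; a (suc k) → refl }
  ; 0-homo = λ { zero → refl ; (suc k) → refl }
  ; 1-homo = λ _ → refl
  }
  where
  scaled-cst : ∀ a b → a · cst b ≗ cst (a *ℤ b)
  scaled-cst a b zero    = refl
  scaled-cst a b (suc k) = ℤ.*-zeroʳ a

cst-≟ : ∀ a b → Maybe (cst a ≗ cst b)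
cst-≟ a b with a ℤ.≟ b
... | yes refl = just λ _ → refl
... | no _     = nothing

-- Numerals are computed in ℤ, so equal polynomials have syntactically equal normal
-- forms and every solver call below is closed by refl.
open import Algebra.Solver.Ring ℤ.+-*-rawRing (fromCommutativeRing Poly-commutativeRing) cst-homomorphism cst-≟
  using (solve; _:=_; Polynomial; con; _:+_; _:*_; _:-_; _:^_)

open CommutativeRing Poly-commutativeRing using (setoid; +-cong)

X-⊛ : ∀ p → X ⊛ p ≗ shift p
X-⊛ p zero    = refl
X-⊛ p (suc k) = begin
  (X ⊛ p) (suc k)         ≡⟨ ⊛-unfoldˡ X p (suc k) ⟩
  +0 + ((X ∘ suc) ⊛ p) k  ≡⟨ ℤ.+-identityˡ _ ⟩
  ((X ∘ suc) ⊛ p) k       ≡⟨ ⊛-cong {q = p} X∘suc≗1 (λ _ → refl) k ⟩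
  (κ 1 ⊛ p) k             ≡⟨ ⊛-identityˡ p k ⟩
  p k                     ∎
  where
  open ≡-Reasoning
  X∘suc≗1 : X ∘ suc ≗ κ 1
  X∘suc≗1 zero    = refl
  X∘suc≗1 (suc k) = refl

coeffs : List ℤ → Poly
coeffs []      _       = +0
coeffs (c ∷ L) zero    = c
coeffs (c ∷ L) (suc k) = coeffs L k

horner : List ℤ → Poly
horner []      = κ 0
horner (c ∷ L) = cst c ⊕ X ⊛ horner L

-- ⟦ hornerₛ L x ⟧ at x = X is definitionally horner L.
hornerₛ : ∀ {n} → List ℤ → Polynomial n → Polynomial n
hornerₛ []      x = con (+ 0)
hornerₛ (c ∷ L) x = con c :+ x :* hornerₛ L x

coeffs≗horner : ∀ L → coeffs L ≗ horner L
coeffs≗horner []      zero    = refl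
coeffs≗horner []      (suc k) = refl
coeffs≗horner (c ∷ L) zero    = sym (ℤ.+-identityʳ c)
coeffs≗horner (c ∷ L) (suc k) =
  trans (coeffs≗horner L k) (trans (sym (X-⊛ (horner L) (suc k))) (sym (ℤ.+-identityˡ _)))

-- Domination as a Boolean fold

foldr-cong : ∀ {n} (f : Bool → Bool → Bool) z {p q : Fin n → Bool} →
  (∀ i → p i ≡ q i) → foldr f z p ≡ foldr f z q
foldr-cong {zero}  f z p≡q = refl
foldr-cong {suc n} f z p≡q = cong₂ f (p≡q zero) (foldr-cong f z (p≡q ∘ suc))

does-any? : ∀ {n} {P : Pred (Fin n) ℓ} (P? : Decidable P) → does (any? P?) ≡ foldr _∨_ false (does ∘ P?)
does-any? {n = zero}  P? = refl
does-any? {n = suc n} P? = cong (does (P? zero) ∨_) (does-any? (P? ∘ suc))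

does-all? : ∀ {n} {P : Pred (Fin n) ℓ} (P? : Decidable P) → does (all? P?) ≡ foldr _∧_ true (does ∘ P?)
does-all? {n = zero}  P? = refl
does-all? {n = suc n} P? = cong (does (P? zero) ∧_) (does-all? (P? ∘ suc))

does-≟-true : ∀ b → does (b 𝔹.≟ true) ≡ b
does-≟-true false = refl
does-≟-true true  = refl

does-∈? : ∀ {n} (x : Fin n) S → does (x ∈? S) ≡ lookup S x
does-∈? zero    (false ∷ S) = refl
does-∈? zero    (true  ∷ S) = refl
does-∈? (suc x) (_ ∷ S)     = does-∈? x S

dominatesᵇ : (G : Graph) → Subset (N G) → Bool
dominatesᵇ G S = foldr _∧_ true λ v → lookup S v ∨ foldr _∨_ false λ u → lookup S u ∧ adj G u v

does-dominating? : ∀ G S → does (dominating? G S) ≡ dominatesᵇ G S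
does-dominating? G S =
  trans (does-all? λ v → (v ∈? S) ⊎-dec any? (nbr? v))
        (foldr-cong _∧_ true λ v → cong₂ _∨_ (does-∈? v S)
          (trans (does-any? (nbr? v))
                 (foldr-cong _∨_ false λ u → cong₂ _∧_ (does-∈? u S) (does-≟-true (adj G u v)))))
  where
  nbr? : ∀ v → Decidable (λ u → u ∈ S × adj G u v ≡ true)
  nbr? v u = (u ∈? S) ×-dec (adj G u v 𝔹.≟ true)

-- Generating polynomials of families of subsets

sizeGF : (m : ℕ) → (Subset m → Bool) → Poly
sizeGF zero    f = if f [] then κ 1 else 0ₚ
sizeGF (suc m) f = sizeGF m (f ∘ (false ∷_)) ⊕ shift (sizeGF m (f ∘ (true ∷_)))

length-filter-map : ∀ {P : Pred B ℓ} (P? : Decidable P) (g : A → B) xs →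
  length (filter P? (map g xs)) ≡ length (filter (P? ∘ g) xs)
length-filter-map P? g []       = refl
length-filter-map P? g (x ∷ xs) with does (P? (g x))
... | true  = cong suc (length-filter-map P? g xs)
... | false = length-filter-map P? g xs

length-filter-cong : ∀ {P Q : Pred A ℓ} (P? : Decidable P) (Q? : Decidable Q) →
  (∀ x → does (P? x) ≡ does (Q? x)) → ∀ xs → length (filter P? xs) ≡ length (filter Q? xs)
length-filter-cong P? Q? eq []       = refl
length-filter-cong P? Q? eq (x ∷ xs) with does (P? x) | does (Q? x) | eq x
... | true  | true  | refl = cong suc (length-filter-cong P? Q? eq xs)
... | false | false | refl = length-filter-cong P? Q? eq xs

length-filter-none : ∀ {P : Pred A ℓ} (P? : Decidable P) →
  (∀ x → does (P? x) ≡ false) → ∀ xs → length (filter P? xs) ≡ 0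
length-filter-none P? none []       = refl
length-filter-none P? none (x ∷ xs) with does (P? x) | none x
... | false | refl = length-filter-none P? none xs

sizeGF-count : ∀ m {P : Pred (Subset m) ℓ} (P? : Decidable P) i →
  + length (filter (λ S → (∣ S ∣ ℕ.≟ i) ×-dec P? S) (allSubsets m)) ≡ sizeGF m (does ∘ P?) i
sizeGF-count zero P? i with does (P? []) | i
... | true  | zero  = refl
... | true  | suc _ = refl
... | false | zero  = refl
... | false | suc _ = refl
sizeGF-count (suc m) {P = P} P? i = begin
  + length (filter R? (map (false ∷_) Sₘ ++ₗ map (true ∷_) Sₘ))
    ≡⟨ cong (+_ ∘ length) (filter-++ R? (map (false ∷_) Sₘ) (map (true ∷_) Sₘ)) ⟩
  + length (filter R? (map (false ∷_) Sₘ) ++ₗ filter R? (map (true ∷_) Sₘ))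
    ≡⟨ cong +_ (length-++ (filter R? (map (false ∷_) Sₘ))) ⟩
  + (length (filter R? (map (false ∷_) Sₘ)) ℕ.+ length (filter R? (map (true ∷_) Sₘ)))
    ≡⟨ ℤ.pos-+ (length (filter R? (map (false ∷_) Sₘ))) (length (filter R? (map (true ∷_) Sₘ))) ⟩
  + length (filter R? (map (false ∷_) Sₘ)) + + length (filter R? (map (true ∷_) Sₘ))
    ≡⟨ cong₂ (λ s t → + s + + t) (length-filter-map R? (false ∷_) Sₘ) (length-filter-map R? (true ∷_) Sₘ) ⟩
  + length (filter (R? ∘ (false ∷_)) Sₘ) + + length (filter (R? ∘ (true ∷_)) Sₘ)
    ≡⟨ cong₂ _+_ (sizeGF-count m (P? ∘ (false ∷_)) i) (count-with-true i) ⟩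
  sizeGF (suc m) (does ∘ P?) i ∎
  where
  open ≡-Reasoning
  Sₘ : List (Subset m)
  Sₘ = allSubsets m
  R? : Decidable (λ S → ∣ S ∣ ≡ i × P S)
  R? S = (∣ S ∣ ℕ.≟ i) ×-dec P? S
  count-with-true : ∀ i → + length (filter (λ S → (∣ true ∷ S ∣ ℕ.≟ i) ×-dec P? (true ∷ S)) Sₘ)
                          ≡ shift (sizeGF m (does ∘ P? ∘ (true ∷_))) i
  count-with-true zero    = cong +_ (length-filter-none _ (λ _ → refl) Sₘ)
  count-with-true (suc i) =
    trans (cong +_ (length-filter-cong _ (λ S → (∣ S ∣ ℕ.≟ i) ×-dec P? (true ∷ S)) (λ _ → refl) Sₘ))
          (sizeGF-count m (P? ∘ (true ∷_)) i)

sizeGF-cong : ∀ m {f g : Subset m → Bool} → (∀ S → f S ≡ g S) → sizeGF m f ≗ sizeGF m g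
sizeGF-cong zero    f≡g k rewrite f≡g [] = refl
sizeGF-cong (suc m) f≡g k =
  cong₂ _+_ (sizeGF-cong m (f≡g ∘ (false ∷_)) k) (shift-cong (sizeGF-cong m (f≡g ∘ (true ∷_))) k)

sizeGF-none : ∀ m → sizeGF m (λ _ → false) ≗ 0ₚ
sizeGF-none zero    k       = refl
sizeGF-none (suc m) zero    = cong (_+ +0) (sizeGF-none m 0)
sizeGF-none (suc m) (suc k) = cong₂ _+_ (sizeGF-none m (suc k)) (sizeGF-none m k)

sizeGF-split : ∀ m (g f : Subset m → Bool) →
  sizeGF m f ≗ sizeGF m (λ S → g S ∧ f S) ⊕ sizeGF m (λ S → not (g S) ∧ f S)
sizeGF-split zero g f i with g []
... | true  = sym (ℤ.+-identityʳ _)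
... | false = sym (ℤ.+-identityˡ _)
sizeGF-split (suc m) g f i = begin
  F₀ i + shift F₁ i
    ≡⟨ cong₂ _+_ (sizeGF-split m (g ∘ (false ∷_)) (f ∘ (false ∷_)) i)
                 (shift-cong (sizeGF-split m (g ∘ (true ∷_)) (f ∘ (true ∷_))) i) ⟩
  (A₀ i + B₀ i) + shift (A₁ ⊕ B₁) i          ≡⟨ cong (_+_ (A₀ i + B₀ i)) (shift-⊕ A₁ B₁ i) ⟩
  (A₀ i + B₀ i) + (shift A₁ i + shift B₁ i)  ≡⟨ interchange (A₀ i) (B₀ i) _ _ ⟩
  (A₀ i + shift A₁ i) + (B₀ i + shift B₁ i)  ∎
  where
  open ≡-Reasoning
  F₀ F₁ A₀ A₁ B₀ B₁ : Poly
  F₀ = sizeGF m (f ∘ (false ∷_))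
  F₁ = sizeGF m (f ∘ (true ∷_))
  A₀ = sizeGF m (λ S → g (false ∷ S) ∧ f (false ∷ S))
  A₁ = sizeGF m (λ S → g (true ∷ S) ∧ f (true ∷ S))
  B₀ = sizeGF m (λ S → not (g (false ∷ S)) ∧ f (false ∷ S))
  B₁ = sizeGF m (λ S → not (g (true ∷ S)) ∧ f (true ∷ S))

sizeGF-++ : ∀ m k (f : Subset (m ℕ.+ k) → Bool) (g : Subset m → Bool) (h : Subset k → Bool) →
  (∀ u v → f (u ++ v) ≡ g u ∧ h v) → sizeGF (m ℕ.+ k) f ≗ sizeGF m g ⊛ sizeGF k h
sizeGF-++ zero k f g h split with g [] | split []
... | true  | f≡h = λ i → trans (sizeGF-cong k f≡h i) (sym (⊛-identityˡ (sizeGF k h) i))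
... | false | f≡∅ = λ i → trans (sizeGF-cong k f≡∅ i) (trans (sizeGF-none k i) (sym (⊛-zeroˡ (sizeGF k h) i)))
sizeGF-++ (suc m) k f g h split i = begin
  sizeGF (m ℕ.+ k) (f ∘ (false ∷_)) i + shift (sizeGF (m ℕ.+ k) (f ∘ (true ∷_))) i
    ≡⟨ cong₂ _+_ (sizeGF-++ m k _ (g ∘ (false ∷_)) h (split ∘ (false ∷_)) i)
                 (shift-cong (sizeGF-++ m k _ (g ∘ (true ∷_)) h (split ∘ (true ∷_))) i) ⟩
  (G₀ ⊛ H) i + shift (G₁ ⊛ H) i  ≡⟨ cong (_+_ ((G₀ ⊛ H) i)) (shift-⊛ G₁ H i) ⟨
  (G₀ ⊛ H) i + (shift G₁ ⊛ H) i  ≡⟨ ⊛-distribʳ H G₀ (shift G₁) i ⟨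
  ((G₀ ⊕ shift G₁) ⊛ H) i        ∎
  where
  open ≡-Reasoning
  G₀ G₁ H : Poly
  G₀ = sizeGF m (g ∘ (false ∷_))
  G₁ = sizeGF m (g ∘ (true ∷_))
  H  = sizeGF k h

sizeGF-^^ : ∀ k (g : Subset k → Bool) (f : ∀ n → Subset (n * k) → Bool) {B : Poly} →
  f 0 [] ≡ true → (∀ n u v → f (suc n) (u ++ v) ≡ g u ∧ f n v) → sizeGF k g ≗ B →
  ∀ n → sizeGF (n * k) (f n) ≗ B ^^ n
sizeGF-^^ k g f f₀ split g≗B zero    i rewrite f₀ = refl
sizeGF-^^ k g f f₀ split g≗B (suc n) i =
  trans (sizeGF-++ k (n * k) (f (suc n)) g (f n) (split n) i) (⊛-cong g≗B (sizeGF-^^ k g f f₀ split g≗B n) i)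

-- The flower

-- c says whether the centre is in S; a, b, e are the petal's vertices in cycle order.
petalDominated : Bool → Subset 3 → Bool
petalDominated c (a ∷ b ∷ e ∷ []) = (a ∨ c ∨ b) ∧ (b ∨ a ∨ e) ∧ (e ∨ c ∨ b)

petalsDominated : Bool → ∀ n → Subset (n * 3) → Bool
petalsDominated c zero    []              = true
petalsDominated c (suc n) (a ∷ b ∷ e ∷ R) = petalDominated c (a ∷ b ∷ e ∷ []) ∧ petalsDominated c n R

touchesCentre : ∀ n → Subset (n * 3) → Bool
touchesCentre zero    []              = false
touchesCentre (suc n) (a ∷ b ∷ e ∷ R) = a ∨ e ∨ touchesCentre n R

flowerDominated : ∀ n → Subset (suc (n * 3)) → Bool
flowerDominated n (c ∷ R) = (c ∨ touchesCentre n R) ∧ petalsDominated c n R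

onlyMiddle : Subset 3 → Bool
onlyMiddle (a ∷ b ∷ e ∷ []) = not a ∧ b ∧ not e

untouchedDominated : ∀ n → Subset (n * 3) → Bool
untouchedDominated n R = not (touchesCentre n R) ∧ petalsDominated false n R

foldr-∨-false : ∀ {n} (p : Fin n → Bool) → foldr _∨_ false (λ i → p i ∧ false) ≡ false
foldr-∨-false {zero}  p = refl
foldr-∨-false {suc n} p rewrite ∧-zeroʳ (p zero) = foldr-∨-false (p ∘ suc)

petalAdj-suc : ∀ {n} (i j : Fin n) r s → petalAdj {suc n} (suc i , r) (suc j , s) ≡ petalAdj (i , r) (j , s)
petalAdj-suc i j r s with i Fin.≟ j
... | yes refl = refl
... | no _     = refl

foldr-touchesCentre : ∀ n R →
  foldr _∨_ false (λ j → lookup R j ∧ centreAdj (proj₂ (remQuot {n} 3 j))) ≡ touchesCentre n R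
foldr-touchesCentre zero    []              = refl
foldr-touchesCentre (suc n) (a ∷ b ∷ e ∷ R)
  rewrite ∧-identityʳ a | ∧-zeroʳ b | ∧-identityʳ e = cong (λ t → a ∨ e ∨ t) (foldr-touchesCentre n R)

foldr-petalsDominated : ∀ n c R →
  foldr _∧_ true (λ j → lookup R j ∨ (c ∧ centreAdj (proj₂ (remQuot {n} 3 j)))
                        ∨ foldr _∨_ false (λ u → lookup R u ∧ petalAdj (remQuot {n} 3 u) (remQuot {n} 3 j)))
  ≡ petalsDominated c n R
foldr-petalsDominated zero    c []              = refl
-- Adjacencies within the first petal are constants, those to later petals are false.
foldr-petalsDominated (suc n) c (a ∷ b ∷ e ∷ R)
  rewrite foldr-∨-false (lookup R)
        | ∧-zeroʳ a | ∧-zeroʳ b | ∧-zeroʳ c | ∧-zeroʳ e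
        | ∧-identityʳ a | ∧-identityʳ b | ∧-identityʳ c | ∧-identityʳ e
        | ∨-identityʳ b | ∨-identityʳ e
  = trans (cong (λ t → (a ∨ c ∨ b) ∧ (b ∨ a ∨ e) ∧ (e ∨ c ∨ b) ∧ t)
            (trans (foldr-cong _∧_ true λ j →
                      cong (λ t → lookup R j ∨ (c ∧ centreAdj (proj₂ (remQuot {n} 3 j))) ∨ t)
                        (foldr-cong _∨_ false λ u → cong (lookup R u ∧_)
                          (petalAdj-suc (proj₁ (remQuot {n} 3 u)) (proj₁ (remQuot {n} 3 j))
                                        (proj₂ (remQuot {n} 3 u)) (proj₂ (remQuot {n} 3 j)))))
                   (foldr-petalsDominated n c R)))
          (sym (trans (∧-assoc (a ∨ c ∨ b) _ _) (cong ((a ∨ c ∨ b) ∧_) (∧-assoc (b ∨ a ∨ e) _ _))))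

dominatesᵇ-F4 : ∀ n S → dominatesᵇ (F4 n) S ≡ flowerDominated n S
dominatesᵇ-F4 n (c ∷ R)
  rewrite ∧-zeroʳ c | foldr-touchesCentre n R | foldr-petalsDominated n c R = refl

petalsDominated-++ : ∀ c n u v →
  petalsDominated c (suc n) (u ++ v) ≡ petalDominated c u ∧ petalsDominated c n v
petalsDominated-++ c n (a ∷ b ∷ e ∷ []) v = refl

untouchedDominated-++ : ∀ n u v →
  untouchedDominated (suc n) (u ++ v) ≡ onlyMiddle u ∧ untouchedDominated n v
untouchedDominated-++ n (true  ∷ b     ∷ e     ∷ []) v = refl
untouchedDominated-++ n (false ∷ true  ∷ true  ∷ []) v = refl
untouchedDominated-++ n (false ∷ false ∷ true  ∷ []) v = refl
untouchedDominated-++ n (false ∷ true  ∷ false ∷ []) v = refl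
untouchedDominated-++ n (false ∷ false ∷ false ∷ []) v = ∧-zeroʳ (not (touchesCentre n v))

P Q : Poly
P = X ⊕ κ 3 ⊛ X ^^ 2 ⊕ X ^^ 3
Q = X ^^ 3 ⊕ κ 3 ⊛ X ^^ 2 ⊕ κ 3 ⊛ X

Pₛ Qₛ : ∀ {n} → Polynomial n → Polynomial n
Pₛ x = x :+ con (+ 3) :* x :^ 2 :+ x :^ 3
Qₛ x = x :^ 3 :+ con (+ 3) :* x :^ 2 :+ con (+ 3) :* x

-- The coefficients of sizeGF 3 g compute, those of P and Q do not: horner bridges the two.
sizeGF-petalWithCentre : sizeGF 3 (petalDominated true) ≗ Q
sizeGF-petalWithCentre k =
  trans (coefficients k) (trans (coeffs≗horner L k) (solve 1 (λ x → hornerₛ L x := Qₛ x) (λ _ → refl) X k))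
  where
  L : List ℤ
  L = + 0 ∷ + 3 ∷ + 3 ∷ + 1 ∷ []
  coefficients : sizeGF 3 (petalDominated true) ≗ coeffs L
  coefficients = λ { 0 → refl ; 1 → refl ; 2 → refl ; 3 → refl ; (suc (suc (suc (suc _)))) → refl }

sizeGF-petalWithoutCentre : sizeGF 3 (petalDominated false) ≗ P
sizeGF-petalWithoutCentre k =
  trans (coefficients k) (trans (coeffs≗horner L k) (solve 1 (λ x → hornerₛ L x := Pₛ x) (λ _ → refl) X k))
  where
  L : List ℤ
  L = + 0 ∷ + 1 ∷ + 3 ∷ + 1 ∷ []
  coefficients : sizeGF 3 (petalDominated false) ≗ coeffs L
  coefficients = λ { 0 → refl ; 1 → refl ; 2 → refl ; 3 → refl ; (suc (suc (suc (suc _)))) → refl }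

sizeGF-onlyMiddle : sizeGF 3 onlyMiddle ≗ X
sizeGF-onlyMiddle k =
  trans (coefficients k) (trans (coeffs≗horner L k) (solve 1 (λ x → hornerₛ L x := x) (λ _ → refl) X k))
  where
  L : List ℤ
  L = + 0 ∷ + 1 ∷ []
  coefficients : sizeGF 3 onlyMiddle ≗ coeffs L
  coefficients = λ { 0 → refl ; 1 → refl ; 2 → refl ; 3 → refl ; (suc (suc (suc (suc _)))) → refl }

D-F4-closedForm : ∀ n → D (F4 n) ≗ P ^^ n ⊖ X ^^ n ⊕ X ⊛ Q ^^ n
D-F4-closedForm n = begin
  D (F4 n)                                ≈⟨ sizeGF-count (suc (n * 3)) (dominating? (F4 n)) ⟩
  sizeGF (suc (n * 3)) (does ∘ dominating? (F4 n))
    ≈⟨ sizeGF-cong (suc (n * 3)) {f = does ∘ dominating? (F4 n)}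
                   (λ S → trans (does-dominating? (F4 n) S) (dominatesᵇ-F4 n S)) ⟩
  T ⊕ shift (sizeGF (n * 3) (petalsDominated true n))
    ≈⟨ +-cong {x = T} (λ _ → refl) (λ k → trans (sym (X-⊛ _ k)) (⊛-cong {p = X} (λ _ → refl) withCentre k)) ⟩
  T ⊕ X ⊛ Q ^^ n
    ≈⟨ solve 3 (λ t c y → t :+ y := t :+ c :- c :+ y) (λ _ → refl) T (X ^^ n) (X ⊛ Q ^^ n) ⟩
  T ⊕ X ^^ n ⊖ X ^^ n ⊕ X ⊛ Q ^^ n
    ≈⟨ (λ k → cong (λ s → s - (X ^^ n) k + (X ⊛ Q ^^ n) k) (withoutCentre k)) ⟩
  P ^^ n ⊖ X ^^ n ⊕ X ⊛ Q ^^ n            ∎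
  where
  open SetoidReasoning setoid
  T : Poly
  T = sizeGF (n * 3) (λ R → touchesCentre n R ∧ petalsDominated false n R)
  withCentre : sizeGF (n * 3) (petalsDominated true n) ≗ Q ^^ n
  withCentre = sizeGF-^^ 3 _ (λ n → petalsDominated true n) refl (petalsDominated-++ true) sizeGF-petalWithCentre n
  withoutCentre : T ⊕ X ^^ n ≗ P ^^ n
  withoutCentre = begin
    T ⊕ X ^^ n
      ≈⟨ +-cong {x = T} (λ _ → refl)
                (sizeGF-^^ 3 onlyMiddle untouchedDominated refl untouchedDominated-++ sizeGF-onlyMiddle n) ⟨
    T ⊕ sizeGF (n * 3) (untouchedDominated n)
      ≈⟨ sizeGF-split (n * 3) (touchesCentre n) (petalsDominated false n) ⟨
    sizeGF (n * 3) (petalsDominated false n)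
      ≈⟨ sizeGF-^^ 3 _ (λ n → petalsDominated false n) refl (petalsDominated-++ false) sizeGF-petalWithoutCentre n ⟩
    P ^^ n ∎

D-F4-one : D (F4 1) ≗ X ^^ 4 ⊕ κ 4 ⊛ X ^^ 3 ⊕ κ 6 ⊛ X ^^ 2
D-F4-one k = trans (D-F4-closedForm 1 k)
  (solve 1 (λ x → Pₛ x :^ 1 :- x :^ 1 :+ x :* Qₛ x :^ 1 := x :^ 4 :+ con (+ 4) :* x :^ 3 :+ con (+ 6) :* x :^ 2)
         (λ _ → refl) X k)

closedForm-step : ∀ a b c →
  P ⊛ b ⊖ X ⊛ c ⊕ X ⊛ (Q ⊛ a) ≗
    ((κ 1 ⊕ X) ^^ 3 ⊕ X) ⊛ (b ⊖ c ⊕ X ⊛ a)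
    ⊖ (κ 1 ⊕ κ 3 ⊛ X) ⊛ b ⊕ (κ 1 ⊕ X) ^^ 3 ⊛ c ⊖ (X ^^ 2 ⊕ X) ⊛ a
closedForm-step = solve 4 (λ x a b c →
    Pₛ x :* b :- x :* c :+ x :* (Qₛ x :* a)
  := ((con (+ 1) :+ x) :^ 3 :+ x) :* (b :- c :+ x :* a) :- (con (+ 1) :+ con (+ 3) :* x) :* b
     :+ (con (+ 1) :+ x) :^ 3 :* c :- (x :^ 2 :+ x) :* a)
  (λ _ → refl) X

D-F4-recurrence : ∀ m → D (F4 (suc m)) ≗
  ((κ 1 ⊕ X) ^^ 3 ⊕ X) ⊛ D (F4 m)
  ⊖ (κ 1 ⊕ κ 3 ⊛ X) ⊛ P ^^ m ⊕ (κ 1 ⊕ X) ^^ 3 ⊛ X ^^ m ⊖ (X ^^ 2 ⊕ X) ⊛ Q ^^ m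
D-F4-recurrence m k = begin
  D (F4 (suc m)) k                                    ≡⟨ D-F4-closedForm (suc m) k ⟩
  (P ^^ suc m ⊖ X ^^ suc m ⊕ X ⊛ Q ^^ suc m) k        ≡⟨ closedForm-step (Q ^^ m) (P ^^ m) (X ^^ m) k ⟩
  (E ⊛ (P ^^ m ⊖ X ^^ m ⊕ X ⊛ Q ^^ m) ⊖ F ⊕ G ⊖ H) k
    ≡⟨ cong (λ s → s - F k + G k - H k) (⊛-cong {p = E} (λ _ → refl) (D-F4-closedForm m) k) ⟨
  (E ⊛ D (F4 m) ⊖ F ⊕ G ⊖ H) k                        ∎
  where
  open ≡-Reasoning
  E F G H : Poly
  E = (κ 1 ⊕ X) ^^ 3 ⊕ X
  F = (κ 1 ⊕ κ 3 ⊛ X) ⊛ P ^^ m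
  G = (κ 1 ⊕ X) ^^ 3 ⊛ X ^^ m
  H = (X ^^ 2 ⊕ X) ⊛ Q ^^ m

-- The hypothesis n ≥ 2 only rules out n = 0: the recurrence already holds for n = 1.
theorem2p4 : (∀ k → D (F4 1) k ≡ (X ^^ 4 ⊕ κ 4 ⊛ X ^^ 3 ⊕ κ 6 ⊛ X ^^ 2) k)
    × (∀ (n : ℕ) → n ≥ 2 → ∀ k →
        D (F4 n) k ≡
          ( ((κ 1 ⊕ X) ^^ 3 ⊕ X) ⊛ D (F4 (n ∸ 1))
          ⊖ (κ 1 ⊕ κ 3 ⊛ X) ⊛ (X ⊕ κ 3 ⊛ X ^^ 2 ⊕ X ^^ 3) ^^ (n ∸ 1)
          ⊕ (κ 1 ⊕ X) ^^ 3 ⊛ X ^^ (n ∸ 1)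
          ⊖ (X ^^ 2 ⊕ X) ⊛ (X ^^ 3 ⊕ κ 3 ⊛ X ^^ 2 ⊕ κ 3 ⊛ X) ^^ (n ∸ 1)) k)
theorem2p4 = D-F4-one , λ { (suc m) _ → D-F4-recurrence m }
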